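{- For doubly regular tournaments $DRT_n$ with $n$ vertices, \[ C(DRT_n)\le \frac12\binom{n}{2}+O(n^{3/2}\log n) \] as $n\to\infty$, with an absolute implied constant.
   Context: A tournament is an orientation of a complete graph. A tournament with $n$ vertices is doubly regular if every vertex has in- and out-degree $(n-1)/2$ and for any two distinct vertices $x,y$, $|N^+(x,y)|=|N^-(x,y)|=(n-3)/4$, where $N^+(x,y)$ is the set of $z$ with $(x,z),(y,z)$ edges and $N^-(x,y)$ the set of $z$ with $(z,x),(z,y)$ edges. For a tournament $T$ on $n$ vertices and a bijection $\sigma:V(T)\to\{1,\dots,n\}$, an edge $(x,y)$ is consistent with $\sigma$ if $\sigma(x)<\sigma(y)$; $C(T)$ is the maximum over $\sigma$ of the number of consistent edges. -}

module Defs where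

open import Data.Nat using (ℕ; zero; suc; _+_; _*_; _<_)
open import Data.Bool using (Bool; true; false; if_then_else_; _∧_; not)
open import Data.Fin using (Fin; toℕ; _<?_)
open import Data.List using (List; map; allFin)
open import Data.Nat.ListAction using (sum)
open import Data.Nat using (_≤_)
open import Data.Product using (_×_; ∃)
open import Data.Fin.Permutation using (Permutation′; _⟨$⟩ʳ_)
open import Relation.Binary.PropositionalEquality using (_≡_; _≢_)
open import Relation.Nullary.Decidable using (⌊_⌋)

count : ∀ {n} → (Fin n → Bool) → ℕ
count {n} p = sum (map (λ i → if p i then 1 else 0) (allFin n))

record Tournament (n : ℕ) : Set where
  field
    adj    : Fin n → Fin n → Bool
    irrefl : ∀ x → adj x x ≡ false
    tourn  : ∀ x y → x ≢ y → adj y x ≡ not (adj x y)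
open Tournament public

outdeg : ∀ {n} → Tournament n → Fin n → ℕ
outdeg T x = count (λ z → adj T x z)

indeg : ∀ {n} → Tournament n → Fin n → ℕ
indeg T x = count (λ z → adj T z x)

commonOut : ∀ {n} → Tournament n → Fin n → Fin n → ℕ
commonOut T x y = count (λ z → adj T x z ∧ adj T y z)

commonIn : ∀ {n} → Tournament n → Fin n → Fin n → ℕ
commonIn T x y = count (λ z → adj T z x ∧ adj T z y)

-- doubly regular: degrees (n-1)/2, |N⁺(x,y)| = |N⁻(x,y)| = (n-3)/4,
-- written multiplicatively to stay in ℕ
record DoublyRegular {n : ℕ} (T : Tournament n) : Set where
  field
    out-reg : ∀ x → 2 * outdeg T x + 1 ≡ n
    in-reg  : ∀ x → 2 * indeg T x + 1 ≡ n
    out-dbl : ∀ x y → x ≢ y → 4 * commonOut T x y + 3 ≡ n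
    in-dbl  : ∀ x y → x ≢ y → 4 * commonIn T x y + 3 ≡ n

consistent : ∀ {n} → Tournament n → Permutation′ n → ℕ
consistent {n} T σ =
  sum (map (λ x → count (λ y → adj T x y ∧ ⌊ (σ ⟨$⟩ʳ x) <? (σ ⟨$⟩ʳ y) ⌋)) (allFin n))

IsC : ∀ {n} → Tournament n → ℕ → Set
IsC T c = (∃ λ σ → consistent T σ ≡ c) × (∀ σ → consistent T σ ≤ c)

-- Let S be the ±1 skew-symmetric adjacency matrix of T. Double regularity says exactly
-- that S Sᵀ = n I − J, so by Cauchy–Schwarz the sum of S over any block A × B of vertex
-- sets is at most √(n |A| |B|) in absolute value. For an ordering σ, the sum of S over
-- the pairs x, y with σ x < σ y is 2·consistent − C(n,2). Split the positions
-- dyadically: the sum over pairs inside an interval of length 2^(k+1) is the sums inside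
-- its two halves plus one block between them of size at most √n·2^k, so inside an
-- interval of length 2^k it is at most √n·k·2^k. It remains to cover the n positions by
-- one interval of length 2^K with K = ⌊log₂ n⌋ + 1.

module Submission where

open import Defs
import Data.Nat as ℕ
import Data.Nat.Properties as ℕₚ
open ℕ using (ℕ; zero; suc; z≤n; s≤s; ⌊_/2⌋)
open import Data.Fin as Fin using (Fin; toℕ)
import Data.Fin.Properties as Finₚ
open import Data.Bool using (Bool; true; false; _∧_; if_then_else_)
open import Data.Product using (_×_; _,_; proj₁; proj₂; ∃₂)
open import Data.Sum using (inj₁; inj₂)
open import Data.Empty using (⊥-elim)
open import Function using (_∘_; id)
open import Relation.Binary.PropositionalEquality
open import Relation.Binary.Definitions using (tri<; tri≈; tri>)
open import Data.Nat.Combinatorics using (_C_; nC1≡n; nCk+nC[k+1]≡[n+1]C[k+1])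
open import Data.Nat.Logarithm using (⌊log₂_⌋; ⌊log₂⌋-mono-≤; ⌊log₂⌊n/2⌋⌋≡⌊log₂n⌋∸1; ⌊log₂[2^n]⌋≡n)
open import Relation.Nullary using (¬_; Dec; does; yes; no)
open import Relation.Nullary.Decidable using (⌊_⌋; isYes≗does; dec-true; dec-false)
open import Data.Fin.Permutation using (Permutation′; _⟨$⟩ʳ_; _⟨$⟩ˡ_; inverseˡ)
open import Data.Integer using (ℤ; +_; -[1+_]; 0ℤ; 1ℤ; _+_; _*_; _-_; -_; _≤_; +≤+; -≤+)
open import Data.Integer.Properties
open import Data.Integer.Tactic.RingSolver using (solve-∀)
open import Algebra.Properties.Semiring.Sum +-*-semiring
  using (sum; sum-cong-≗; ∑-distrib-+; ∑-comm; sum-permute; *-distribˡ-sum; *-distribʳ-sum; sum-replicate-zero)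
import Data.Nat.ListAction as ListAction
import Data.List as List
import Data.Nat.Tactic.RingSolver as NatSolver
import Data.List.Properties as Listₚ

open ≤-Reasoning

sum-neg : ∀ {m} (f : Fin m → ℤ) → sum (λ i → - f i) ≡ - sum f
sum-neg {zero}  f = refl
sum-neg {suc m} f = trans (cong (_+_ (- f Fin.zero)) (sum-neg (f ∘ Fin.suc)))
                          (sym (neg-distrib-+ (f Fin.zero) _))

sum-sub : ∀ {m} (f g : Fin m → ℤ) → sum (λ i → f i - g i) ≡ sum f - sum g
sum-sub f g = trans (∑-distrib-+ f (λ i → - g i)) (cong (_+_ (sum f)) (sum-neg g))

sum-mono-≤ : ∀ {m} {f g : Fin m → ℤ} → (∀ i → f i ≤ g i) → sum f ≤ sum g
sum-mono-≤ {zero}  f≤g = ≤-refl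
sum-mono-≤ {suc m} f≤g = +-mono-≤ (f≤g Fin.zero) (sum-mono-≤ (f≤g ∘ Fin.suc))

sum-nonneg : ∀ {m} {f : Fin m → ℤ} → (∀ i → 0ℤ ≤ f i) → 0ℤ ≤ sum f
sum-nonneg {m} {f} 0≤f = subst (_≤ sum f) (sum-replicate-zero m) (sum-mono-≤ 0≤f)

sum-+₃ : ∀ {m} (f g h : Fin m → ℤ) → sum (λ i → f i + g i + h i) ≡ sum f + sum g + sum h
sum-+₃ f g h = trans (∑-distrib-+ (λ i → f i + g i) h) (cong (_+ sum h) (∑-distrib-+ f g))

sum-const : ∀ m x → sum {m} (λ _ → x) ≡ + m * x
sum-const zero    x = refl
sum-const (suc m) x = begin-equality
  x + sum {m} (λ _ → x) ≡⟨ cong (_+_ x) (sum-const m x) ⟩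
  x + + m * x           ≡⟨ cong (_+ + m * x) (*-identityˡ x) ⟨
  1ℤ * x + + m * x      ≡⟨ *-distribʳ-+ x 1ℤ (+ m) ⟨
  (1ℤ + + m) * x        ≡⟨ cong (_* x) (pos-+ 1 m) ⟨
  + suc m * x           ∎

sum-*-sum : ∀ {m k} (f : Fin m → ℤ) (g : Fin k → ℤ) →
            sum f * sum g ≡ sum (λ i → sum (λ j → f i * g j))
sum-*-sum f g = trans (*-distribʳ-sum (sum g) f)
                      (sum-cong-≗ (λ i → *-distribˡ-sum (f i) g))

⟦_⟧ : Bool → ℤ
⟦ true  ⟧ = 1ℤ
⟦ false ⟧ = 0ℤ

⟦∧⟧ : ∀ a b → ⟦ a ∧ b ⟧ ≡ ⟦ a ⟧ * ⟦ b ⟧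
⟦∧⟧ true  b = sym (*-identityˡ ⟦ b ⟧)
⟦∧⟧ false b = refl

⟦⟧-nonneg : ∀ b → 0ℤ ≤ ⟦ b ⟧
⟦⟧-nonneg true  = +≤+ z≤n
⟦⟧-nonneg false = +≤+ z≤n

⟦⟧-idem : ∀ b → ⟦ b ⟧ * ⟦ b ⟧ ≡ ⟦ b ⟧
⟦⟧-idem true  = refl
⟦⟧-idem false = refl

⟦⟧*-≤ : ∀ b {y} → 0ℤ ≤ y → ⟦ b ⟧ * y ≤ y
⟦⟧*-≤ true  {y} _   = ≤-reflexive (*-identityˡ y)
⟦⟧*-≤ false     0≤y = 0≤y

listSum-as-sum : ∀ {m} (g : Fin m → ℕ) → + ListAction.sum (List.map g (List.allFin m)) ≡ sum (λ i → + g i)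
listSum-as-sum g = trans (cong (+_ ∘ ListAction.sum) (Listₚ.map-tabulate id g)) (tabulate-as-sum g)
  where
  tabulate-as-sum : ∀ {k} (g : Fin k → ℕ) → + ListAction.sum (List.tabulate g) ≡ sum (λ i → + g i)
  tabulate-as-sum {zero}  g = refl
  tabulate-as-sum {suc k} g = trans (pos-+ (g Fin.zero) _) (cong (_+_ (+ g Fin.zero)) (tabulate-as-sum (g ∘ Fin.suc)))

count-as-sum : ∀ {m} (p : Fin m → Bool) → + count p ≡ sum (λ i → ⟦ p i ⟧)
count-as-sum p = trans (listSum-as-sum (λ i → if p i then 1 else 0)) (sum-cong-≗ (λ i → ⟦⟧-as-if (p i)))
  where
  ⟦⟧-as-if : ∀ b → + (if b then 1 else 0) ≡ ⟦ b ⟧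
  ⟦⟧-as-if true  = refl
  ⟦⟧-as-if false = refl

δ : ∀ {m} → Fin m → Fin m → ℤ
δ i j = ⟦ does (i Finₚ.≟ j) ⟧

δ-≢ : ∀ {m} {i j : Fin m} → i ≢ j → δ i j ≡ 0ℤ
δ-≢ {i = i} {j} i≢j = cong ⟦_⟧ (dec-false (i Finₚ.≟ j) i≢j)

δ-sym : ∀ {m} (i j : Fin m) → δ i j ≡ δ j i
δ-sym i j with i Finₚ.≟ j | j Finₚ.≟ i
... | yes _   | yes _   = refl
... | no  _   | no  _   = refl
... | yes i≡j | no  j≢i = ⊥-elim (j≢i (sym i≡j))
... | no  i≢j | yes j≡i = ⊥-elim (i≢j (sym j≡i))

sum-δ : ∀ {m} (i : Fin m) (g : Fin m → ℤ) → sum (λ j → δ j i * g j) ≡ g i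
sum-δ {suc m} Fin.zero g = begin-equality
  1ℤ * g Fin.zero + sum (λ j → 0ℤ * g (Fin.suc j))
    ≡⟨ cong₂ _+_ (*-identityˡ (g Fin.zero)) (sum-cong-≗ (λ j → *-zeroˡ (g (Fin.suc j)))) ⟩
  g Fin.zero + sum {m} (λ _ → 0ℤ)                  ≡⟨ cong (_+_ (g Fin.zero)) (sum-replicate-zero m) ⟩
  g Fin.zero + 0ℤ                                  ≡⟨ +-identityʳ _ ⟩
  g Fin.zero                                       ∎
sum-δ {suc m} (Fin.suc i) g = trans (+-identityˡ _) (sum-δ i (g ∘ Fin.suc))

sum-δ-const : ∀ {m} (i : Fin m) → sum (λ j → δ j i) ≡ 1ℤ
sum-δ-const i = trans (sum-cong-≗ (λ j → sym (*-identityʳ (δ j i)))) (sum-δ i (λ _ → 1ℤ))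

sum-1-δ : ∀ {m} (a : Fin m) → sum (λ v → 1ℤ - δ v a) ≡ + m - 1ℤ
sum-1-δ {m} a = begin-equality
  sum (λ v → 1ℤ - δ v a)                   ≡⟨ sum-sub (λ _ → 1ℤ) (λ v → δ v a) ⟩
  sum {m} (λ _ → 1ℤ) - sum (λ v → δ v a)   ≡⟨ cong₂ _-_ (trans (sum-const m 1ℤ) (*-identityʳ (+ m))) (sum-δ-const a) ⟩
  + m - 1ℤ                                 ∎

sum-[1-δ][1-δ] : ∀ {m} (a b : Fin m) →
                 sum (λ v → (1ℤ - δ v a) * (1ℤ - δ v b)) ≡ + m - 1ℤ - (1ℤ - δ a b)
sum-[1-δ][1-δ] {m} a b = begin-equality
  sum (λ v → (1ℤ - δ v a) * (1ℤ - δ v b))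
    ≡⟨ sum-cong-≗ (λ v → expand (δ v a) (δ v b)) ⟩
  sum (λ v → (1ℤ - δ v b) - δ v a * (1ℤ - δ v b))
    ≡⟨ sum-sub (λ v → 1ℤ - δ v b) (λ v → δ v a * (1ℤ - δ v b)) ⟩
  sum (λ v → 1ℤ - δ v b) - sum (λ v → δ v a * (1ℤ - δ v b))
    ≡⟨ cong₂ _-_ (sum-1-δ b) (sum-δ a (λ v → 1ℤ - δ v b)) ⟩
  + m - 1ℤ - (1ℤ - δ a b) ∎
  where
  expand : ∀ x y → (1ℤ - x) * (1ℤ - y) ≡ (1ℤ - y) - x * (1ℤ - y)
  expand = solve-∀

*-monoˡ-≤-0≤ : ∀ {c a b} → 0ℤ ≤ c → a ≤ b → c * a ≤ c * b
*-monoˡ-≤-0≤ {+ k} _ = *-monoˡ-≤-nonNeg (+ k)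

*-monoʳ-≤-0≤ : ∀ {c a b} → 0ℤ ≤ c → a ≤ b → a * c ≤ b * c
*-monoʳ-≤-0≤ {+ k} _ = *-monoʳ-≤-nonNeg (+ k)

*-0≤ : ∀ {a b} → 0ℤ ≤ a → 0ℤ ≤ b → 0ℤ ≤ a * b
*-0≤ {a} {b} 0≤a 0≤b = subst (_≤ a * b) (*-zeroʳ a) (*-monoˡ-≤-0≤ 0≤a 0≤b)

i-j≤i-0≤ : ∀ {i j} → 0ℤ ≤ j → i - j ≤ i
i-j≤i-0≤ {i} {+ k} _ = i-j≤i i (+ k)

square-0≤ : ∀ x → 0ℤ ≤ x * x
square-0≤ (+ k)    = subst (0ℤ ≤_) (pos-* k k) (+≤+ z≤n)
square-0≤ -[1+ k ] = +≤+ z≤n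

square-∸-≤ : ∀ a b → + (a ℕ.∸ b) * + (a ℕ.∸ b) ≤ (+ a - + b) * (+ a - + b)
square-∸-≤ a b with ℕₚ.≤-total b a
... | inj₁ b≤a = ≤-reflexive (cong (λ t → t * t) (sym (trans (m-n≡m⊖n a b) (⊖-≥ b≤a))))
... | inj₂ a≤b rewrite ℕₚ.m≤n⇒m∸n≡0 a≤b = square-0≤ (+ a - + b)

square-mono-≤ : ∀ {x y} → 0ℤ ≤ x → x ≤ y → x * x ≤ y * y
square-mono-≤ 0≤x x≤y = ≤-trans (*-monoʳ-≤-0≤ 0≤x x≤y) (*-monoˡ-≤-0≤ (≤-trans 0≤x x≤y) x≤y)

square-cancel-≤ : ∀ {x y} → 0ℤ ≤ y → x * x ≤ y * y → x ≤ y
square-cancel-≤ { -[1+ a ]} {+ b} _ _ = -≤+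
square-cancel-≤ {+ a} {+ b} _ a²≤b² =
  +≤+ (ℕ-square-cancel (drop‿+≤+ (subst₂ _≤_ (sym (pos-* a a)) (sym (pos-* b b)) a²≤b²)))
  where
  ℕ-square-cancel : a ℕ.* a ℕ.≤ b ℕ.* b → a ℕ.≤ b
  ℕ-square-cancel a²≤b² with a ℕ.≤? b
  ... | yes a≤b = a≤b
  ... | no  a≰b = ⊥-elim (ℕₚ.<⇒≱ (ℕₚ.*-mono-< (ℕₚ.≰⇒> a≰b) (ℕₚ.≰⇒> a≰b)) a²≤b²)

square-≤-scaled-+ : ∀ {N a b A B} → 0ℤ ≤ N → 0ℤ ≤ A → 0ℤ ≤ B →
                    a * a ≤ N * (A * A) → b * b ≤ N * (B * B) →
                    (a + b) * (a + b) ≤ N * ((A + B) * (A + B))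
square-≤-scaled-+ {N} {a} {b} {A} {B} 0≤N 0≤A 0≤B a²≤ b²≤ = begin
  (a + b) * (a + b)                                 ≡⟨ expand a b ⟩
  a * a + + 2 * (a * b) + b * b                     ≤⟨ +-mono-≤ (+-mono-≤ a²≤ (*-monoˡ-≤-0≤ {+ 2} (+≤+ z≤n) ab≤)) b²≤ ⟩
  N * (A * A) + + 2 * (N * A * B) + N * (B * B)     ≡⟨ collect N A B ⟩
  N * ((A + B) * (A + B))                           ∎
  where
  expand : ∀ a b → (a + b) * (a + b) ≡ a * a + + 2 * (a * b) + b * b
  expand = solve-∀
  collect : ∀ N A B → N * (A * A) + + 2 * (N * A * B) + N * (B * B) ≡ N * ((A + B) * (A + B))
  collect = solve-∀
  regroup₁ : ∀ a b → (a * b) * (a * b) ≡ (a * a) * (b * b)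
  regroup₁ = solve-∀
  regroup₂ : ∀ N A B → (N * (A * A)) * (N * (B * B)) ≡ (N * A * B) * (N * A * B)
  regroup₂ = solve-∀
  ab≤ : a * b ≤ N * A * B
  ab≤ = square-cancel-≤ (*-0≤ (*-0≤ 0≤N 0≤A) 0≤B) (begin
    (a * b) * (a * b)             ≡⟨ regroup₁ a b ⟩
    (a * a) * (b * b)             ≤⟨ *-monoʳ-≤-0≤ (square-0≤ b) a²≤ ⟩
    (N * (A * A)) * (b * b)       ≤⟨ *-monoˡ-≤-0≤ (*-0≤ 0≤N (square-0≤ A)) b²≤ ⟩
    (N * (A * A)) * (N * (B * B)) ≡⟨ regroup₂ N A B ⟩
    (N * A * B) * (N * A * B)     ∎)

-- Lagrange's identity: the double sum of w i w j (x i - x j)² equals 2 (W Q - S²).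
cauchy-schwarz : ∀ {m} (w x : Fin m → ℤ) → (∀ i → 0ℤ ≤ w i) →
                 sum (λ i → w i * x i) * sum (λ i → w i * x i) ≤ sum w * sum (λ i → w i * (x i * x i))
cauchy-schwarz {m} w x 0≤w = 0≤i-j⇒j≤i (*-cancelˡ-≤-pos 0ℤ (W * Q - S * S) (+ 2)
                                          (subst (_≤ + 2 * (W * Q - S * S)) (sym (*-zeroʳ (+ 2))) 0≤2[WQ-S²]))
  where
  W S Q : ℤ
  W = sum w
  S = sum (λ i → w i * x i)
  Q = sum (λ i → w i * (x i * x i))
  q e : Fin m → ℤ
  q i = w i * (x i * x i)
  e i = w i * x i
  pointwise : ∀ wi wj xi xj → wi * wj * ((xi - xj) * (xi - xj)) ≡
              wi * (xi * xi) * wj + wi * (wj * (xj * xj)) + - (+ 2) * (wi * xi * (wj * xj))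
  pointwise = solve-∀
  rearrange : ∀ Q W S → Q * W + W * Q + - (+ 2) * (S * S) ≡ + 2 * (W * Q - S * S)
  rearrange = solve-∀
  sum-+-+-* : ∀ {k} (f g h : Fin k → ℤ) c → sum (λ j → f j + g j + c * h j) ≡ sum f + sum g + c * sum h
  sum-+-+-* f g h c = trans (∑-distrib-+ (λ j → f j + g j) (λ j → c * h j))
                            (cong₂ _+_ (∑-distrib-+ f g) (sym (*-distribˡ-sum c h)))
  lagrange : sum (λ i → sum (λ j → w i * w j * ((x i - x j) * (x i - x j)))) ≡ + 2 * (W * Q - S * S)
  lagrange = begin-equality
    sum (λ i → sum (λ j → w i * w j * ((x i - x j) * (x i - x j))))
      ≡⟨ sum-cong-≗ (λ i → trans (sum-cong-≗ (λ j → pointwise (w i) (w j) (x i) (x j)))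
                                 (sum-+-+-* (λ j → q i * w j) (λ j → w i * q j) (λ j → e i * e j) (- (+ 2)))) ⟩
    sum (λ i → sum (λ j → q i * w j) + sum (λ j → w i * q j) + - (+ 2) * sum (λ j → e i * e j))
      ≡⟨ sum-+-+-* (λ i → sum (λ j → q i * w j)) (λ i → sum (λ j → w i * q j)) (λ i → sum (λ j → e i * e j)) (- (+ 2)) ⟩
    sum (λ i → sum (λ j → q i * w j)) + sum (λ i → sum (λ j → w i * q j)) + - (+ 2) * sum (λ i → sum (λ j → e i * e j))
      ≡⟨ sym (cong₂ _+_ (cong₂ _+_ (sum-*-sum q w) (sum-*-sum w q)) (cong (- (+ 2) *_) (sum-*-sum e e))) ⟩
    Q * W + W * Q + - (+ 2) * (S * S)
      ≡⟨ rearrange Q W S ⟩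
    + 2 * (W * Q - S * S) ∎
  0≤2[WQ-S²] : 0ℤ ≤ + 2 * (W * Q - S * S)
  0≤2[WQ-S²] = subst (0ℤ ≤_) lagrange
    (sum-nonneg (λ i → sum-nonneg (λ j → *-0≤ (*-0≤ (0≤w i) (0≤w j)) (square-0≤ (x i - x j)))))

size : ∀ {m} → (Fin m → Bool) → ℤ
size R = sum (λ i → ⟦ R i ⟧)

size-0≤ : ∀ {m} (R : Fin m → Bool) → 0ℤ ≤ size R
size-0≤ R = sum-nonneg (λ i → ⟦⟧-nonneg (R i))

cut : ∀ {m} → (Fin m → Fin m → ℤ) → (Fin m → Bool) → (Fin m → Bool) → ℤ
cut s R R′ = sum (λ i → sum (λ j → ⟦ R i ⟧ * ⟦ R′ j ⟧ * s i j))

module _ {m : ℕ} (s : Fin m → Fin m → ℤ) (N : ℕ)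
         (gram : ∀ a b → sum (λ v → s a v * s b v) ≡ + N * δ a b - 1ℤ) where

  columnSum : (Fin m → Bool) → Fin m → ℤ
  columnSum R v = sum (λ i → ⟦ R i ⟧ * s i v)

  -- Σ_v (columnSum R v)² = 1_Rᵀ S Sᵀ 1_R = N |R| − |R|².
  sum-columnSum-square-≤ : ∀ R → sum (λ v → columnSum R v * columnSum R v) ≤ + N * size R
  sum-columnSum-square-≤ R = begin
    sum (λ v → columnSum R v * columnSum R v)
      ≡⟨ sum-cong-≗ (λ v → sum-*-sum (λ i → ⟦ R i ⟧ * s i v) (λ i′ → ⟦ R i′ ⟧ * s i′ v)) ⟩
    sum (λ v → sum (λ i → sum (λ i′ → (⟦ R i ⟧ * s i v) * (⟦ R i′ ⟧ * s i′ v))))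
      ≡⟨ ∑-comm (λ v i → sum (λ i′ → (⟦ R i ⟧ * s i v) * (⟦ R i′ ⟧ * s i′ v))) ⟩
    sum (λ i → sum (λ v → sum (λ i′ → (⟦ R i ⟧ * s i v) * (⟦ R i′ ⟧ * s i′ v))))
      ≡⟨ sum-cong-≗ (λ i → ∑-comm (λ v i′ → (⟦ R i ⟧ * s i v) * (⟦ R i′ ⟧ * s i′ v))) ⟩
    sum (λ i → sum (λ i′ → sum (λ v → (⟦ R i ⟧ * s i v) * (⟦ R i′ ⟧ * s i′ v))))
      ≡⟨ sum-cong-≗ (λ i → sum-cong-≗ (λ i′ → inner i i′)) ⟩
    sum (λ i → sum (λ i′ → (⟦ R i ⟧ * ⟦ R i′ ⟧) * (+ N * δ i i′ - 1ℤ)))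
      ≤⟨ sum-mono-≤ (λ i → sum-mono-≤ (λ i′ → drop-J i i′)) ⟩
    sum (λ i → sum (λ i′ → (+ N * ⟦ R i ⟧) * (δ i′ i * ⟦ R i′ ⟧)))
      ≡⟨ sum-cong-≗ (λ i → trans (sym (*-distribˡ-sum (+ N * ⟦ R i ⟧) (λ i′ → δ i′ i * ⟦ R i′ ⟧)))
                                 (cong (+ N * ⟦ R i ⟧ *_) (sum-δ i (λ i′ → ⟦ R i′ ⟧)))) ⟩
    sum (λ i → + N * ⟦ R i ⟧ * ⟦ R i ⟧)
      ≡⟨ sum-cong-≗ (λ i → trans (*-assoc (+ N) _ _) (cong (+ N *_) (⟦⟧-idem (R i)))) ⟩
    sum (λ i → + N * ⟦ R i ⟧)
      ≡⟨ *-distribˡ-sum (+ N) (λ i → ⟦ R i ⟧) ⟨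
    + N * size R ∎
    where
    regroup : ∀ x y a b → (x * a) * (y * b) ≡ (x * y) * (a * b)
    regroup = solve-∀
    inner : ∀ i i′ → sum (λ v → (⟦ R i ⟧ * s i v) * (⟦ R i′ ⟧ * s i′ v)) ≡ (⟦ R i ⟧ * ⟦ R i′ ⟧) * (+ N * δ i i′ - 1ℤ)
    inner i i′ = begin-equality
      sum (λ v → (⟦ R i ⟧ * s i v) * (⟦ R i′ ⟧ * s i′ v)) ≡⟨ sum-cong-≗ (λ v → regroup ⟦ R i ⟧ ⟦ R i′ ⟧ (s i v) (s i′ v)) ⟩
      sum (λ v → (⟦ R i ⟧ * ⟦ R i′ ⟧) * (s i v * s i′ v)) ≡⟨ *-distribˡ-sum (⟦ R i ⟧ * ⟦ R i′ ⟧) (λ v → s i v * s i′ v) ⟨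
      (⟦ R i ⟧ * ⟦ R i′ ⟧) * sum (λ v → s i v * s i′ v)  ≡⟨ cong (⟦ R i ⟧ * ⟦ R i′ ⟧ *_) (gram i i′) ⟩
      (⟦ R i ⟧ * ⟦ R i′ ⟧) * (+ N * δ i i′ - 1ℤ)          ∎
    expand : ∀ x y N d → (x * y) * (N * d - 1ℤ) ≡ (N * x) * (d * y) - x * y
    expand = solve-∀
    drop-J : ∀ i i′ → (⟦ R i ⟧ * ⟦ R i′ ⟧) * (+ N * δ i i′ - 1ℤ) ≤ (+ N * ⟦ R i ⟧) * (δ i′ i * ⟦ R i′ ⟧)
    drop-J i i′ = begin
      (⟦ R i ⟧ * ⟦ R i′ ⟧) * (+ N * δ i i′ - 1ℤ)          ≡⟨ expand ⟦ R i ⟧ ⟦ R i′ ⟧ (+ N) (δ i i′) ⟩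
      (+ N * ⟦ R i ⟧) * (δ i i′ * ⟦ R i′ ⟧) - ⟦ R i ⟧ * ⟦ R i′ ⟧ ≤⟨ i-j≤i-0≤ (*-0≤ (⟦⟧-nonneg (R i)) (⟦⟧-nonneg (R i′))) ⟩
      (+ N * ⟦ R i ⟧) * (δ i i′ * ⟦ R i′ ⟧)                ≡⟨ cong (λ d → (+ N * ⟦ R i ⟧) * (d * ⟦ R i′ ⟧)) (δ-sym i i′) ⟩
      (+ N * ⟦ R i ⟧) * (δ i′ i * ⟦ R i′ ⟧)                ∎

  cut-square-≤ : ∀ R R′ → cut s R R′ * cut s R R′ ≤ + N * (size R * size R′)
  cut-square-≤ R R′ = begin
    cut s R R′ * cut s R R′
      ≡⟨ cong (λ t → t * t) cut-as-columnSums ⟩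
    sum (λ j → ⟦ R′ j ⟧ * u j) * sum (λ j → ⟦ R′ j ⟧ * u j)
      ≤⟨ cauchy-schwarz (λ j → ⟦ R′ j ⟧) u (λ j → ⟦⟧-nonneg (R′ j)) ⟩
    size R′ * sum (λ j → ⟦ R′ j ⟧ * (u j * u j))
      ≤⟨ *-monoˡ-≤-0≤ (size-0≤ R′) (sum-mono-≤ (λ j → ⟦⟧*-≤ (R′ j) (square-0≤ (u j)))) ⟩
    size R′ * sum (λ j → u j * u j)
      ≤⟨ *-monoˡ-≤-0≤ (size-0≤ R′) (sum-columnSum-square-≤ R) ⟩
    size R′ * (+ N * size R)
      ≡⟨ regroup (size R′) (+ N) (size R) ⟩
    + N * (size R * size R′) ∎
    where
    u : Fin m → ℤ
    u = columnSum R
    regroup : ∀ a b c → a * (b * c) ≡ b * (c * a)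
    regroup = solve-∀
    reorder : ∀ x y z → x * y * z ≡ y * (x * z)
    reorder = solve-∀
    cut-as-columnSums : cut s R R′ ≡ sum (λ j → ⟦ R′ j ⟧ * u j)
    cut-as-columnSums = trans (∑-comm (λ i j → ⟦ R i ⟧ * ⟦ R′ j ⟧ * s i j))
      (sum-cong-≗ (λ j → trans (sum-cong-≗ (λ i → reorder ⟦ R i ⟧ ⟦ R′ j ⟧ (s i j)))
                               (sym (*-distribˡ-sum ⟦ R′ j ⟧ (λ i → ⟦ R i ⟧ * s i j)))))

⌊⌋-yes : ∀ {a} {A : Set a} (d : Dec A) → A → ⌊ d ⌋ ≡ true
⌊⌋-yes d a = trans (isYes≗does d) (dec-true d a)

⌊⌋-no : ∀ {a} {A : Set a} (d : Dec A) → ¬ A → ⌊ d ⌋ ≡ false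
⌊⌋-no d ¬a = trans (isYes≗does d) (dec-false d ¬a)

⌊⌋-sound : ∀ {a} {A : Set a} (d : Dec A) → ⌊ d ⌋ ≡ true → A
⌊⌋-sound (yes a) _ = a

inRange : ℕ → ℕ → ℕ → Bool
inRange lo hi p = ⌊ lo ℕ.≤? p ⌋ ∧ ⌊ p ℕ.<? hi ⌋

inRange-sound : ∀ {lo hi} p → inRange lo hi p ≡ true → lo ℕ.≤ p × p ℕ.< hi
inRange-sound {lo} {hi} p e with ⌊ lo ℕ.≤? p ⌋ in lo≤p | ⌊ p ℕ.<? hi ⌋ in p<hi
... | true | true = ⌊⌋-sound (lo ℕ.≤? p) lo≤p , ⌊⌋-sound (p ℕ.<? hi) p<hi

inRange-below : ∀ {lo mid hi p} → p ℕ.< mid → mid ℕ.≤ hi →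
                (inRange lo hi p ≡ inRange lo mid p) × (inRange mid hi p ≡ false)
inRange-below {lo} {mid} {hi} {p} p<mid mid≤hi
  rewrite ⌊⌋-yes (p ℕ.<? hi) (ℕₚ.<-≤-trans p<mid mid≤hi) | ⌊⌋-yes (p ℕ.<? mid) p<mid
        | ⌊⌋-no (mid ℕ.≤? p) (ℕₚ.<⇒≱ p<mid) = refl , refl

inRange-above : ∀ {lo mid hi p} → mid ℕ.≤ p → lo ℕ.≤ mid →
                (inRange lo hi p ≡ inRange mid hi p) × (inRange lo mid p ≡ false)
inRange-above {lo} {mid} {hi} {p} mid≤p lo≤mid
  rewrite ⌊⌋-yes (lo ℕ.≤? p) (ℕₚ.≤-trans lo≤mid mid≤p) | ⌊⌋-yes (mid ℕ.≤? p) mid≤p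
        | ⌊⌋-no (p ℕ.<? mid) (ℕₚ.≤⇒≯ mid≤p) = refl , refl

sum-inRange-≤ : ∀ lo hi {m} o → sum {m} (λ k → ⟦ inRange lo hi (o ℕ.+ toℕ k) ⟧) ≤ + (hi ℕ.∸ (lo ℕ.⊔ o))
sum-inRange-≤ lo hi {zero}  o = +≤+ z≤n
sum-inRange-≤ lo hi {suc m} o = begin
  ⟦ inRange lo hi (o ℕ.+ 0) ⟧ + sum {m} (λ k → ⟦ inRange lo hi (o ℕ.+ suc (toℕ k)) ⟧)
    ≡⟨ cong₂ _+_ (cong (⟦_⟧ ∘ inRange lo hi) (ℕₚ.+-identityʳ o))
                 (sum-cong-≗ {m} (λ k → cong (⟦_⟧ ∘ inRange lo hi) (ℕₚ.+-suc o (toℕ k)))) ⟩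
  ⟦ inRange lo hi o ⟧ + sum {m} (λ k → ⟦ inRange lo hi (suc o ℕ.+ toℕ k) ⟧)
    ≤⟨ +-monoʳ-≤ ⟦ inRange lo hi o ⟧ (sum-inRange-≤ lo hi {m} (suc o)) ⟩
  ⟦ inRange lo hi o ⟧ + + (hi ℕ.∸ (lo ℕ.⊔ suc o))
    ≤⟨ step ⟩
  + (hi ℕ.∸ (lo ℕ.⊔ o)) ∎
  where
  step : ⟦ inRange lo hi o ⟧ + + (hi ℕ.∸ (lo ℕ.⊔ suc o)) ≤ + (hi ℕ.∸ (lo ℕ.⊔ o))
  step with lo ℕ.≤? o | o ℕ.<? hi
  ... | yes lo≤o | yes o<hi
    rewrite ℕₚ.m≤n⇒m⊔n≡n (ℕₚ.m≤n⇒m≤1+n lo≤o) | ℕₚ.m≤n⇒m⊔n≡n lo≤o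
    = ≤-reflexive (trans (sym (pos-+ 1 (hi ℕ.∸ suc o))) (cong +_ (sym (ℕₚ.+-∸-assoc 1 o<hi))))
  ... | no lo≰o | _
    rewrite ℕₚ.m≥n⇒m⊔n≡m (ℕₚ.≰⇒> lo≰o) | ℕₚ.m≥n⇒m⊔n≡m (ℕₚ.<⇒≤ (ℕₚ.≰⇒> lo≰o))
    = ≤-reflexive (+-identityˡ _)
  ... | yes lo≤o | no o≮hi
    rewrite ℕₚ.m≤n⇒m∸n≡0 (ℕₚ.≤-trans (ℕₚ.m≤n⇒m≤1+n (ℕₚ.≮⇒≥ o≮hi)) (ℕₚ.m≤n⊔m lo (suc o)))
    = +≤+ z≤n

sum-inRange-toℕ-≤ : ∀ lo hi {m} → sum {m} (λ k → ⟦ inRange lo hi (toℕ k) ⟧) ≤ + (hi ℕ.∸ lo)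
sum-inRange-toℕ-≤ lo hi {m} =
  subst (λ l → sum {m} (λ k → ⟦ inRange lo hi (toℕ k) ⟧) ≤ + (hi ℕ.∸ l)) (ℕₚ.⊔-identityʳ lo) (sum-inRange-≤ lo hi {m} 0)

⟦inRange⟧-split : ∀ {lo mid hi} p → lo ℕ.≤ mid → mid ℕ.≤ hi →
                  ⟦ inRange lo hi p ⟧ ≡ ⟦ inRange lo mid p ⟧ + ⟦ inRange mid hi p ⟧
⟦inRange⟧-split {lo} {mid} {hi} p lo≤mid mid≤hi with ℕₚ.<-≤-connex p mid
... | inj₁ p<mid
  rewrite proj₁ (inRange-below {lo} {mid} {hi} p<mid mid≤hi) | proj₂ (inRange-below {lo} {mid} {hi} p<mid mid≤hi)
  = sym (+-identityʳ _)
... | inj₂ mid≤p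
  rewrite proj₁ (inRange-above {lo} {mid} {hi} mid≤p lo≤mid) | proj₂ (inRange-above {lo} {mid} {hi} mid≤p lo≤mid)
  = sym (+-identityˡ _)

dyadicBound : ℕ → ℤ
dyadicBound k = + (k ℕ.* 2 ℕ.^ k)

module Blocks {m : ℕ} (s : Fin m → Fin m → ℤ) (pos : Fin m → ℕ) where

  interval : ℕ → ℕ → Fin m → Bool
  interval lo hi x = inRange lo hi (pos x)

  before : Fin m → Fin m → Bool
  before x y = ⌊ pos x ℕ.<? pos y ⌋

  block : ℕ → ℕ → ℤ
  block lo hi = sum (λ x → sum (λ y → ⟦ interval lo hi x ⟧ * ⟦ interval lo hi y ⟧ * ⟦ before x y ⟧ * s x y))

  orderedSum : ℤ
  orderedSum = sum (λ x → sum (λ y → ⟦ before x y ⟧ * s x y))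

  block-whole : ∀ hi → (∀ x → pos x ℕ.< hi) → block 0 hi ≡ orderedSum
  block-whole hi pos<hi = sum-cong-≗ (λ x → sum-cong-≗ (λ y → pointwise x y))
    where
    interval-whole : ∀ x → interval 0 hi x ≡ true
    interval-whole x rewrite ⌊⌋-yes (0 ℕ.≤? pos x) z≤n | ⌊⌋-yes (pos x ℕ.<? hi) (pos<hi x) = refl
    pointwise : ∀ x y → ⟦ interval 0 hi x ⟧ * ⟦ interval 0 hi y ⟧ * ⟦ before x y ⟧ * s x y ≡ ⟦ before x y ⟧ * s x y
    pointwise x y rewrite interval-whole x | interval-whole y = cong (_* s x y) (*-identityˡ ⟦ before x y ⟧)

  lower-before-upper : ∀ lo mid hi x y →
    ⟦ interval lo mid x ⟧ * ⟦ interval mid hi y ⟧ * ⟦ before x y ⟧ ≡ ⟦ interval lo mid x ⟧ * ⟦ interval mid hi y ⟧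
  lower-before-upper lo mid hi x y with interval lo mid x in x∈ | interval mid hi y in y∈
  ... | false | _     = refl
  ... | true  | false = refl
  ... | true  | true  = cong (λ b → 1ℤ * ⟦ b ⟧) (⌊⌋-yes (pos x ℕ.<? pos y)
        (ℕₚ.<-≤-trans (proj₂ (inRange-sound {lo} {mid} (pos x) x∈)) (proj₁ (inRange-sound {mid} {hi} (pos y) y∈))))

  upper-not-before-lower : ∀ lo mid hi x y →
    ⟦ interval mid hi x ⟧ * ⟦ interval lo mid y ⟧ * ⟦ before x y ⟧ ≡ 0ℤ
  upper-not-before-lower lo mid hi x y with interval mid hi x in x∈ | interval lo mid y in y∈
  ... | false | _     = refl
  ... | true  | false = refl
  ... | true  | true  = cong (λ b → 1ℤ * ⟦ b ⟧) (⌊⌋-no (pos x ℕ.<? pos y)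
        (ℕₚ.<⇒≯ (ℕₚ.<-≤-trans (proj₂ (inRange-sound {lo} {mid} (pos y) y∈)) (proj₁ (inRange-sound {mid} {hi} (pos x) x∈)))))

  block-split : ∀ lo mid hi → lo ℕ.≤ mid → mid ℕ.≤ hi →
                block lo hi ≡ block lo mid + block mid hi + cut s (interval lo mid) (interval mid hi)
  block-split lo mid hi lo≤mid mid≤hi =
    trans (sum-cong-≗ (λ x → trans (sum-cong-≗ (λ y → pointwise x y))
                                   (sum-+₃ (λ y → L x y) (λ y → U x y) (λ y → C x y))))
          (sum-+₃ (λ x → sum (L x)) (λ x → sum (U x)) (λ x → sum (C x)))
    where
    L U C : Fin m → Fin m → ℤ
    L x y = ⟦ interval lo mid x ⟧ * ⟦ interval lo mid y ⟧ * ⟦ before x y ⟧ * s x y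
    U x y = ⟦ interval mid hi x ⟧ * ⟦ interval mid hi y ⟧ * ⟦ before x y ⟧ * s x y
    C x y = ⟦ interval lo mid x ⟧ * ⟦ interval mid hi y ⟧ * s x y
    expand : ∀ xL xU yL yU b t → (xL + xU) * (yL + yU) * b * t ≡
             xL * yL * b * t + xU * yU * b * t + (xL * yU * b * t + xU * yL * b * t)
    expand = solve-∀
    pointwise : ∀ x y → ⟦ interval lo hi x ⟧ * ⟦ interval lo hi y ⟧ * ⟦ before x y ⟧ * s x y ≡ L x y + U x y + C x y
    pointwise x y = begin-equality
      ⟦ interval lo hi x ⟧ * ⟦ interval lo hi y ⟧ * ⟦ before x y ⟧ * s x y
        ≡⟨ cong₂ (λ a b → a * b * ⟦ before x y ⟧ * s x y)
                 (⟦inRange⟧-split {lo} {mid} {hi} (pos x) lo≤mid mid≤hi)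
                 (⟦inRange⟧-split {lo} {mid} {hi} (pos y) lo≤mid mid≤hi) ⟩
      (⟦ interval lo mid x ⟧ + ⟦ interval mid hi x ⟧) * (⟦ interval lo mid y ⟧ + ⟦ interval mid hi y ⟧)
        * ⟦ before x y ⟧ * s x y
        ≡⟨ expand ⟦ interval lo mid x ⟧ ⟦ interval mid hi x ⟧ ⟦ interval lo mid y ⟧ ⟦ interval mid hi y ⟧
                  ⟦ before x y ⟧ (s x y) ⟩
      L x y + U x y + (⟦ interval lo mid x ⟧ * ⟦ interval mid hi y ⟧ * ⟦ before x y ⟧ * s x y
                       + ⟦ interval mid hi x ⟧ * ⟦ interval lo mid y ⟧ * ⟦ before x y ⟧ * s x y)
        ≡⟨ cong (λ t → L x y + U x y + t)
                (cong₂ (λ a b → a * s x y + b * s x y)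
                       (lower-before-upper lo mid hi x y) (upper-not-before-lower lo mid hi x y)) ⟩
      L x y + U x y + (C x y + 0ℤ * s x y)
        ≡⟨ cong (λ t → L x y + U x y + t) (+-identityʳ (C x y)) ⟩
      L x y + U x y + C x y ∎

  block-singleton : ∀ lo → block lo (suc lo) ≡ 0ℤ
  block-singleton lo = trans (sum-cong-≗ (λ x → trans (sum-cong-≗ (pointwise x)) (sum-replicate-zero m)))
                             (sum-replicate-zero m)
    where
    pointwise : ∀ x y → ⟦ interval lo (suc lo) x ⟧ * ⟦ interval lo (suc lo) y ⟧ * ⟦ before x y ⟧ * s x y ≡ 0ℤ
    pointwise x y with interval lo (suc lo) x in x∈ | interval lo (suc lo) y in y∈
    ... | false | _     = refl
    ... | true  | false = refl
    ... | true  | true  = cong (λ b → 1ℤ * ⟦ b ⟧ * s x y) (⌊⌋-no (pos x ℕ.<? pos y)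
          (ℕₚ.≤⇒≯ (ℕₚ.≤-trans (ℕ.s≤s⁻¹ (proj₂ (inRange-sound {lo} {suc lo} (pos y) y∈)))
                              (proj₁ (inRange-sound {lo} {suc lo} (pos x) x∈)))))

  module _ (N : ℕ)
           (cut-≤ : ∀ R R′ → cut s R R′ * cut s R R′ ≤ + N * (size R * size R′))
           (interval-size-≤ : ∀ lo hi → size (interval lo hi) ≤ + (hi ℕ.∸ lo)) where

    cut-adjacent-≤ : ∀ lo p → let mid = lo ℕ.+ p; c = cut s (interval lo mid) (interval mid (mid ℕ.+ p)) in
                     c * c ≤ + N * (+ p * + p)
    cut-adjacent-≤ lo p = ≤-trans (cut-≤ _ _)
      (*-monoˡ-≤-nonNeg (+ N) (≤-trans (*-monoʳ-≤-0≤ (size-0≤ (interval mid (mid ℕ.+ p))) (length-≤ lo))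
                                         (*-monoˡ-≤-nonNeg (+ p) (length-≤ mid))))
      where
      mid = lo ℕ.+ p
      length-≤ : ∀ a → size (interval a (a ℕ.+ p)) ≤ + p
      length-≤ a = subst (λ l → size (interval a (a ℕ.+ p)) ≤ + l) (ℕₚ.m+n∸m≡n a p) (interval-size-≤ a (a ℕ.+ p))

    block-dyadic-≤ : ∀ k lo → block lo (lo ℕ.+ 2 ℕ.^ k) * block lo (lo ℕ.+ 2 ℕ.^ k) ≤ + N * (dyadicBound k * dyadicBound k)
    block-dyadic-≤ zero lo rewrite ℕₚ.+-comm lo 1 | block-singleton lo = *-0≤ {+ N} (+≤+ z≤n) (square-0≤ (dyadicBound 0))
    block-dyadic-≤ (suc k) lo = begin
      block lo (lo ℕ.+ 2 ℕ.* p) * block lo (lo ℕ.+ 2 ℕ.* p)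
        ≡⟨ cong (λ b → b * b) halves ⟩
      (block lo mid + block mid (mid ℕ.+ p) + c) * (block lo mid + block mid (mid ℕ.+ p) + c)
        ≤⟨ square-≤-scaled-+ {a = block lo mid + block mid (mid ℕ.+ p)} {b = c} 0≤N (+-mono-≤ 0≤W 0≤W) 0≤p
             (square-≤-scaled-+ {a = block lo mid} {b = block mid (mid ℕ.+ p)} 0≤N 0≤W 0≤W
                (block-dyadic-≤ k lo) (block-dyadic-≤ k mid))
             (cut-adjacent-≤ lo p) ⟩
      + N * ((dyadicBound k + dyadicBound k + + p) * (dyadicBound k + dyadicBound k + + p))
        ≤⟨ *-monoˡ-≤-nonNeg (+ N) (square-mono-≤ (+≤+ z≤n) bound-step) ⟩
      + N * (dyadicBound (suc k) * dyadicBound (suc k)) ∎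
      where
      p = 2 ℕ.^ k
      0≤N : 0ℤ ≤ + N
      0≤N = +≤+ z≤n
      0≤W : 0ℤ ≤ dyadicBound k
      0≤W = +≤+ z≤n
      0≤p : 0ℤ ≤ + p
      0≤p = +≤+ z≤n
      mid = lo ℕ.+ p
      c = cut s (interval lo mid) (interval mid (mid ℕ.+ p))
      halves : block lo (lo ℕ.+ 2 ℕ.* p) ≡ block lo mid + block mid (mid ℕ.+ p) + c
      halves = trans (cong (block lo) (assoc lo p))
                     (block-split lo mid (mid ℕ.+ p) (ℕₚ.m≤m+n lo p) (ℕₚ.m≤m+n mid p))
        where
        assoc : ∀ lo p → lo ℕ.+ 2 ℕ.* p ≡ lo ℕ.+ p ℕ.+ p
        assoc = NatSolver.solve-∀
      bound-step : dyadicBound k + dyadicBound k + + p ≤ dyadicBound (suc k)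
      bound-step = subst (_≤ dyadicBound (suc k)) (trans (pos-+ (w ℕ.+ w) p) (cong (_+ + p) (pos-+ w w)))
                         (+≤+ (ℕₚ.≤-trans (ℕₚ.m≤m+n (w ℕ.+ w ℕ.+ p) p) (ℕₚ.≤-reflexive (doubling k p))))
        where
        w = k ℕ.* p
        doubling : ∀ k p → k ℕ.* p ℕ.+ k ℕ.* p ℕ.+ p ℕ.+ p ≡ suc k ℕ.* (2 ℕ.* p)
        doubling = NatSolver.solve-∀

size-permuted-interval-≤ : ∀ {m} (σ : Permutation′ m) lo hi →
                           size (λ x → inRange lo hi (toℕ (σ ⟨$⟩ʳ x))) ≤ + (hi ℕ.∸ lo)
size-permuted-interval-≤ {m} σ lo hi =
  subst (_≤ + (hi ℕ.∸ lo)) (sum-permute (λ i → ⟦ inRange lo hi (toℕ i) ⟧) σ) (sum-inRange-toℕ-≤ lo hi {m})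

2*nC2≡n*[n∸1] : ∀ m → 2 ℕ.* (m C 2) ≡ m ℕ.* (m ℕ.∸ 1)
2*nC2≡n*[n∸1] zero    = refl
2*nC2≡n*[n∸1] (suc m) =
  trans (cong (2 ℕ.*_) (trans (sym (nCk+nC[k+1]≡[n+1]C[k+1] m 1)) (cong (ℕ._+ m C 2) (nC1≡n m))))
        (trans (ℕₚ.*-distribˡ-+ 2 m (m C 2)) (trans (cong (2 ℕ.* m ℕ.+_) (2*nC2≡n*[n∸1] m)) (step m)))
  where
  step : ∀ m → 2 ℕ.* m ℕ.+ m ℕ.* (m ℕ.∸ 1) ≡ suc m ℕ.* m
  step zero    = refl
  step (suc k) = identity k
    where
    identity : ∀ k → 2 ℕ.* suc k ℕ.+ suc k ℕ.* k ≡ suc (suc k) ℕ.* suc k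
    identity = NatSolver.solve-∀

module _ {n : ℕ} (T : Tournament n) where

  sign : Fin n → Fin n → ℤ
  sign x y = ⟦ adj T x y ⟧ - ⟦ adj T y x ⟧

  ⟦adj⟧+⟦adj⟧ : ∀ a v → ⟦ adj T a v ⟧ + ⟦ adj T v a ⟧ ≡ 1ℤ - δ v a
  ⟦adj⟧+⟦adj⟧ a v with v Finₚ.≟ a
  ... | yes refl rewrite irrefl T v = refl
  ... | no  v≢a rewrite tourn T a v (v≢a ∘ sym) with adj T a v
  ...   | true  = refl
  ...   | false = refl

  sign-square : ∀ a v → sign a v * sign a v ≡ 1ℤ - δ v a
  sign-square a v with v Finₚ.≟ a
  ... | yes refl rewrite irrefl T v = refl
  ... | no  v≢a rewrite tourn T a v (v≢a ∘ sym) with adj T a v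
  ...   | true  = refl
  ...   | false = refl

  sign-gram-diagonal : ∀ a → sum (λ v → sign a v * sign a v) ≡ + n - 1ℤ
  sign-gram-diagonal a = trans (sum-cong-≗ (sign-square a)) (sum-1-δ a)

  sign-gram : ∀ a b → sum (λ v → sign a v * sign b v) ≡
              + 2 * (+ commonOut T a b + + commonIn T a b) - (+ n - 1ℤ - (1ℤ - δ a b))
  sign-gram a b = begin-equality
    sum (λ v → sign a v * sign b v)
      ≡⟨ sum-cong-≗ pointwise ⟩
    sum (λ v → + 2 * (⟦ out v ⟧ + ⟦ in′ v ⟧) - (1ℤ - δ v a) * (1ℤ - δ v b))
      ≡⟨ sum-sub (λ v → + 2 * (⟦ out v ⟧ + ⟦ in′ v ⟧)) (λ v → (1ℤ - δ v a) * (1ℤ - δ v b)) ⟩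
    sum (λ v → + 2 * (⟦ out v ⟧ + ⟦ in′ v ⟧)) - sum (λ v → (1ℤ - δ v a) * (1ℤ - δ v b))
      ≡⟨ cong₂ _-_ common (sum-[1-δ][1-δ] a b) ⟩
    + 2 * (+ commonOut T a b + + commonIn T a b) - (+ n - 1ℤ - (1ℤ - δ a b)) ∎
    where
    out in′ : Fin n → Bool
    out v = adj T a v ∧ adj T b v
    in′ v = adj T v a ∧ adj T v b
    identity : ∀ x x′ y y′ → (x - x′) * (y - y′) ≡ + 2 * (x * y + x′ * y′) - (x + x′) * (y + y′)
    identity = solve-∀
    pointwise : ∀ v → sign a v * sign b v ≡ + 2 * (⟦ out v ⟧ + ⟦ in′ v ⟧) - (1ℤ - δ v a) * (1ℤ - δ v b)
    pointwise v = begin-equality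
      sign a v * sign b v
        ≡⟨ identity ⟦ adj T a v ⟧ ⟦ adj T v a ⟧ ⟦ adj T b v ⟧ ⟦ adj T v b ⟧ ⟩
      + 2 * (⟦ adj T a v ⟧ * ⟦ adj T b v ⟧ + ⟦ adj T v a ⟧ * ⟦ adj T v b ⟧)
        - (⟦ adj T a v ⟧ + ⟦ adj T v a ⟧) * (⟦ adj T b v ⟧ + ⟦ adj T v b ⟧)
        ≡⟨ cong₂ (λ s t → + 2 * s - t)
             (sym (cong₂ _+_ (⟦∧⟧ (adj T a v) (adj T b v)) (⟦∧⟧ (adj T v a) (adj T v b))))
             (cong₂ _*_ (⟦adj⟧+⟦adj⟧ a v) (⟦adj⟧+⟦adj⟧ b v)) ⟩
      + 2 * (⟦ out v ⟧ + ⟦ in′ v ⟧) - (1ℤ - δ v a) * (1ℤ - δ v b) ∎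
    common : sum (λ v → + 2 * (⟦ out v ⟧ + ⟦ in′ v ⟧)) ≡ + 2 * (+ commonOut T a b + + commonIn T a b)
    common = begin-equality
      sum (λ v → + 2 * (⟦ out v ⟧ + ⟦ in′ v ⟧))       ≡⟨ *-distribˡ-sum (+ 2) (λ v → ⟦ out v ⟧ + ⟦ in′ v ⟧) ⟨
      + 2 * sum (λ v → ⟦ out v ⟧ + ⟦ in′ v ⟧)         ≡⟨ cong (+ 2 *_) (∑-distrib-+ (λ v → ⟦ out v ⟧) (λ v → ⟦ in′ v ⟧)) ⟩
      + 2 * (sum (λ v → ⟦ out v ⟧) + sum (λ v → ⟦ in′ v ⟧))
                                                      ≡⟨ cong (+ 2 *_) (sym (cong₂ _+_ (count-as-sum out) (count-as-sum in′))) ⟩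
      + 2 * (+ commonOut T a b + + commonIn T a b)    ∎

  doublyRegular⇒sign-gram-≢ : DoublyRegular T → ∀ {a b} → a ≢ b → sum (λ v → sign a v * sign b v) ≡ - 1ℤ
  doublyRegular⇒sign-gram-≢ dr {a} {b} a≢b = begin-equality
    sum (λ v → sign a v * sign b v)
      ≡⟨ sign-gram a b ⟩
    + 2 * (+ commonOut T a b + c) - (+ n - 1ℤ - (1ℤ - δ a b))
      ≡⟨ cong₂ (λ o d → + 2 * (+ o + c) - (+ n - 1ℤ - (1ℤ - d))) out≡in (δ-≢ a≢b) ⟩
    + 2 * (c + c) - (+ n - 1ℤ - (1ℤ - 0ℤ))
      ≡⟨ cong (λ m → + 2 * (c + c) - (m - 1ℤ - (1ℤ - 0ℤ))) n≡4c+3 ⟩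
    + 2 * (c + c) - (+ 4 * c + + 3 - 1ℤ - (1ℤ - 0ℤ))
      ≡⟨ arith c ⟩
    - 1ℤ ∎
    where
    open DoublyRegular dr
    c : ℤ
    c = + commonIn T a b
    out≡in : commonOut T a b ≡ commonIn T a b
    out≡in = ℕₚ.*-cancelˡ-≡ _ _ 4 (ℕₚ.+-cancelʳ-≡ _ _ _ (trans (out-dbl a b a≢b) (sym (in-dbl a b a≢b))))
    n≡4c+3 : + n ≡ + 4 * c + + 3
    n≡4c+3 = trans (cong +_ (sym (in-dbl a b a≢b)))
                   (trans (pos-+ (4 ℕ.* commonIn T a b) 3) (cong (_+ + 3) (pos-* 4 (commonIn T a b))))
    arith : ∀ c → + 2 * (c + c) - (+ 4 * c + + 3 - 1ℤ - (1ℤ - 0ℤ)) ≡ - 1ℤ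
    arith = solve-∀

  doublyRegular⇒sign-gram : DoublyRegular T → ∀ a b → sum (λ v → sign a v * sign b v) ≡ + n * δ a b - 1ℤ
  doublyRegular⇒sign-gram dr a b with a Finₚ.≟ b
  ... | yes refl = trans (sign-gram-diagonal a) (cong (_- 1ℤ) (sym (*-identityʳ (+ n))))
  ... | no  a≢b  = trans (doublyRegular⇒sign-gram-≢ dr a≢b) (cong (_- 1ℤ) (sym (*-zeroʳ (+ n))))

  edges-regular : (∀ x → 2 ℕ.* outdeg T x ℕ.+ 1 ≡ n) → sum (λ x → sum (λ y → ⟦ adj T x y ⟧)) ≡ + (n C 2)
  edges-regular out-reg = *-cancelˡ-≡ (+ 2) _ _ (begin-equality
    + 2 * sum (λ x → sum (λ y → ⟦ adj T x y ⟧))     ≡⟨ *-distribˡ-sum (+ 2) (λ x → sum (λ y → ⟦ adj T x y ⟧)) ⟩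
    sum (λ x → + 2 * sum (λ y → ⟦ adj T x y ⟧))     ≡⟨ sum-cong-≗ (λ x → cong (+ 2 *_) (sym (count-as-sum (adj T x)))) ⟩
    sum (λ x → + 2 * + outdeg T x)                   ≡⟨ sum-cong-≗ twice-outdeg ⟩
    sum {n} (λ _ → + (n ℕ.∸ 1))                      ≡⟨ sum-const n (+ (n ℕ.∸ 1)) ⟩
    + n * + (n ℕ.∸ 1)                                ≡⟨ pos-* n (n ℕ.∸ 1) ⟨
    + (n ℕ.* (n ℕ.∸ 1))                              ≡⟨ cong +_ (2*nC2≡n*[n∸1] n) ⟨
    + (2 ℕ.* (n C 2))                                ≡⟨ pos-* 2 (n C 2) ⟩
    + 2 * + (n C 2)                                  ∎)
    where
    twice-outdeg : ∀ x → + 2 * + outdeg T x ≡ + (n ℕ.∸ 1)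
    twice-outdeg x = trans (sym (pos-* 2 (outdeg T x)))
      (cong +_ (trans (sym (ℕₚ.m+n∸n≡m (2 ℕ.* outdeg T x) 1)) (cong (ℕ._∸ 1) (out-reg x))))

  module _ (σ : Permutation′ n) where

    position : Fin n → ℕ
    position x = toℕ (σ ⟨$⟩ʳ x)

    position-injective : ∀ {x y} → position x ≡ position y → x ≡ y
    position-injective {x} {y} eq =
      trans (sym (inverseˡ σ)) (trans (cong (σ ⟨$⟩ˡ_) (Finₚ.toℕ-injective eq)) (inverseˡ σ))

    open Blocks sign position

    forward backward : ℤ
    forward  = sum (λ x → sum (λ y → ⟦ adj T x y ⟧ * ⟦ before x y ⟧))
    backward = sum (λ x → sum (λ y → ⟦ adj T y x ⟧ * ⟦ before x y ⟧))

    -- Fin's _<?_ compares toℕ's with ℕ's _<?_, so the predicate counted by consistent is adj ∧ before.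
    consistent≡forward : + consistent T σ ≡ forward
    consistent≡forward = trans (listSum-as-sum (λ x → count (λ y → adj T x y ∧ before x y)))
      (sum-cong-≗ (λ x → trans (count-as-sum (λ y → adj T x y ∧ before x y))
                               (sum-cong-≗ (λ y → ⟦∧⟧ (adj T x y) (before x y)))))

    forward+backward : forward + backward ≡ sum (λ x → sum (λ y → ⟦ adj T x y ⟧))
    forward+backward = begin-equality
      forward + backward
        ≡⟨ cong (_+_ forward) (∑-comm (λ x y → ⟦ adj T y x ⟧ * ⟦ before x y ⟧)) ⟩
      forward + sum (λ x → sum (λ y → ⟦ adj T x y ⟧ * ⟦ before y x ⟧))
        ≡⟨ sym (∑-distrib-+ (λ x → sum (λ y → ⟦ adj T x y ⟧ * ⟦ before x y ⟧))
                            (λ x → sum (λ y → ⟦ adj T x y ⟧ * ⟦ before y x ⟧))) ⟩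
      sum (λ x → sum (λ y → ⟦ adj T x y ⟧ * ⟦ before x y ⟧) + sum (λ y → ⟦ adj T x y ⟧ * ⟦ before y x ⟧))
        ≡⟨ sum-cong-≗ (λ x → trans (sym (∑-distrib-+ (λ y → ⟦ adj T x y ⟧ * ⟦ before x y ⟧)
                                                    (λ y → ⟦ adj T x y ⟧ * ⟦ before y x ⟧)))
                                   (sum-cong-≗ (edge-one-way x))) ⟩
      sum (λ x → sum (λ y → ⟦ adj T x y ⟧)) ∎
      where
      edge-one-way : ∀ x y → ⟦ adj T x y ⟧ * ⟦ before x y ⟧ + ⟦ adj T x y ⟧ * ⟦ before y x ⟧ ≡ ⟦ adj T x y ⟧
      edge-one-way x y with ℕₚ.<-cmp (position x) (position y)
      ... | tri≈ _ x=y _ rewrite position-injective x=y | irrefl T y = refl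
      ... | tri< x<y _ y≮x
        rewrite ⌊⌋-yes (position x ℕ.<? position y) x<y | ⌊⌋-no (position y ℕ.<? position x) y≮x
        with adj T x y
      ...   | true  = refl
      ...   | false = refl
      edge-one-way x y | tri> x≮y _ y<x
        rewrite ⌊⌋-no (position x ℕ.<? position y) x≮y | ⌊⌋-yes (position y ℕ.<? position x) y<x
        with adj T x y
      ...   | true  = refl
      ...   | false = refl

    orderedSum≡forward-backward : orderedSum ≡ forward - backward
    orderedSum≡forward-backward = begin-equality
      sum (λ x → sum (λ y → ⟦ before x y ⟧ * sign x y))
        ≡⟨ sum-cong-≗ (λ x → trans (sum-cong-≗ (λ y → expand ⟦ before x y ⟧ ⟦ adj T x y ⟧ ⟦ adj T y x ⟧))
                                   (sum-sub (λ y → ⟦ adj T x y ⟧ * ⟦ before x y ⟧) (λ y → ⟦ adj T y x ⟧ * ⟦ before x y ⟧))) ⟩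
      sum (λ x → sum (λ y → ⟦ adj T x y ⟧ * ⟦ before x y ⟧) - sum (λ y → ⟦ adj T y x ⟧ * ⟦ before x y ⟧))
        ≡⟨ sum-sub (λ x → sum (λ y → ⟦ adj T x y ⟧ * ⟦ before x y ⟧)) (λ x → sum (λ y → ⟦ adj T y x ⟧ * ⟦ before x y ⟧)) ⟩
      forward - backward ∎
      where
      expand : ∀ b a a′ → b * (a - a′) ≡ a * b - a′ * b
      expand = solve-∀

    orderedSum≡2c-C : (∀ x → 2 ℕ.* outdeg T x ℕ.+ 1 ≡ n) → orderedSum ≡ + 2 * + consistent T σ - + (n C 2)
    orderedSum≡2c-C out-reg = begin-equality
      orderedSum                                    ≡⟨ orderedSum≡forward-backward ⟩
      forward - backward                            ≡⟨ rearrange forward backward ⟩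
      + 2 * forward - (forward + backward)          ≡⟨ cong₂ (λ f e → + 2 * f - e) (sym consistent≡forward)
                                                             (trans forward+backward (edges-regular out-reg)) ⟩
      + 2 * + consistent T σ - + (n C 2)            ∎
      where
      rearrange : ∀ f b → f - b ≡ + 2 * f - (f + b)
      rearrange = solve-∀

    consistent-deviation-≤ : DoublyRegular T → ∀ K → n ℕ.≤ 2 ℕ.^ K →
      (+ 2 * + consistent T σ - + (n C 2)) * (+ 2 * + consistent T σ - + (n C 2)) ≤ + n * (dyadicBound K * dyadicBound K)
    consistent-deviation-≤ dr K n≤2^K =
      subst (λ d → d * d ≤ + n * (dyadicBound K * dyadicBound K))
            (trans (block-whole (2 ℕ.^ K) (λ x → ℕₚ.<-≤-trans (Finₚ.toℕ<n (σ ⟨$⟩ʳ x)) n≤2^K))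
                   (orderedSum≡2c-C (DoublyRegular.out-reg dr)))
            (block-dyadic-≤ n (cut-square-≤ sign n (doublyRegular⇒sign-gram dr)) (size-permuted-interval-≤ σ) K 0)

  doublyRegular⇒deviation-≤ : DoublyRegular T → (σ : Permutation′ n) → ∀ K → n ℕ.≤ 2 ℕ.^ K →
    let E = 2 ℕ.* consistent T σ ℕ.∸ n C 2 in E ℕ.* E ℕ.≤ n ℕ.* ((K ℕ.* 2 ℕ.^ K) ℕ.* (K ℕ.* 2 ℕ.^ K))
  doublyRegular⇒deviation-≤ dr σ K n≤2^K = drop‿+≤+ (begin
    + (E ℕ.* E)                                    ≡⟨ pos-* E E ⟩
    + E * + E                                      ≤⟨ square-∸-≤ (2 ℕ.* c) (n C 2) ⟩
    (+ (2 ℕ.* c) - + (n C 2)) * (+ (2 ℕ.* c) - + (n C 2))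
                                                   ≡⟨ cong (λ t → (t - + (n C 2)) * (t - + (n C 2))) (pos-* 2 c) ⟩
    (+ 2 * + c - + (n C 2)) * (+ 2 * + c - + (n C 2)) ≤⟨ consistent-deviation-≤ σ dr K n≤2^K ⟩
    + n * (+ W * + W)                              ≡⟨ cong (+ n *_) (pos-* W W) ⟨
    + n * + (W ℕ.* W)                              ≡⟨ pos-* n (W ℕ.* W) ⟨
    + (n ℕ.* (W ℕ.* W))                            ∎)
    where
    c = consistent T σ
    E = 2 ℕ.* c ℕ.∸ n C 2
    W = K ℕ.* 2 ℕ.^ K

2^⌊log₂n⌋≤n : ∀ n → 1 ℕ.≤ n → 2 ℕ.^ ⌊log₂ n ⌋ ℕ.≤ n
2^⌊log₂n⌋≤n n 1≤n = go ⌊log₂ n ⌋ n 1≤n refl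
  where
  go : ∀ L m → 1 ℕ.≤ m → ⌊log₂ m ⌋ ≡ L → 2 ℕ.^ L ℕ.≤ m
  go zero          m                 1≤m _  = 1≤m
  go (suc L)       (suc zero)        _   eq = ⊥-elim (ℕₚ.0≢1+n eq)
  go (suc L) m@(suc (suc k)) _   eq = ℕₚ.≤-trans (ℕₚ.*-monoʳ-≤ 2 half-bound) twice-half≤
    where
    half-bound : 2 ℕ.^ L ℕ.≤ ⌊ m /2⌋
    half-bound = go L ⌊ m /2⌋ (s≤s z≤n) (trans (⌊log₂⌊n/2⌋⌋≡⌊log₂n⌋∸1 m) (cong (ℕ._∸ 1) eq))
    twice-half≤ : 2 ℕ.* ⌊ m /2⌋ ℕ.≤ m
    twice-half≤ = subst (2 ℕ.* ⌊ m /2⌋ ℕ.≤_) (ℕₚ.⌊n/2⌋+⌈n/2⌉≡n m)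
      (ℕₚ.+-monoʳ-≤ ⌊ m /2⌋ (ℕₚ.≤-trans (ℕₚ.≤-reflexive (ℕₚ.+-identityʳ ⌊ m /2⌋)) (ℕₚ.⌊n/2⌋≤⌈n/2⌉ m)))

n≤2^[1+⌊log₂n⌋] : ∀ n → n ℕ.≤ 2 ℕ.^ suc ⌊log₂ n ⌋
n≤2^[1+⌊log₂n⌋] n with n ℕ.≤? 2 ℕ.^ suc ⌊log₂ n ⌋
... | yes n≤ = n≤
... | no  n≰ = ⊥-elim (ℕₚ.1+n≰n (subst (ℕ._≤ ⌊log₂ n ⌋) (⌊log₂[2^n]⌋≡n (suc ⌊log₂ n ⌋))
                                      (⌊log₂⌋-mono-≤ (ℕₚ.<⇒≤ (ℕₚ.≰⇒> n≰)))))

1≤⌊log₂n⌋ : ∀ {n} → 2 ℕ.≤ n → 1 ℕ.≤ ⌊log₂ n ⌋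
1≤⌊log₂n⌋ {n} 2≤n = subst (ℕ._≤ ⌊log₂ n ⌋) (⌊log₂[2^n]⌋≡n 1) (⌊log₂⌋-mono-≤ 2≤n)

-- (L + 1)·2^(L+1) ≤ 2L·2n once 1 ≤ L and 2^L ≤ n, whence the constant 16.
dyadic-≤-log : ∀ n L E → 1 ℕ.≤ L → 2 ℕ.^ L ℕ.≤ n →
               E ℕ.* E ℕ.≤ n ℕ.* ((suc L ℕ.* 2 ℕ.^ suc L) ℕ.* (suc L ℕ.* 2 ℕ.^ suc L)) →
               E ℕ.^ 2 ℕ.≤ 16 ℕ.* n ℕ.^ 3 ℕ.* L ℕ.^ 2
dyadic-≤-log n L E 1≤L 2^L≤n E²≤ =
  subst₂ ℕ._≤_ (square E) (regroup n L) (ℕₚ.≤-trans E²≤ (ℕₚ.*-monoʳ-≤ n (ℕₚ.*-mono-≤ bound bound)))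
  where
  bound : suc L ℕ.* 2 ℕ.^ suc L ℕ.≤ (2 ℕ.* L) ℕ.* (2 ℕ.* n)
  bound = ℕₚ.*-mono-≤ (ℕₚ.≤-trans (ℕₚ.+-monoˡ-≤ L 1≤L) (ℕₚ.≤-reflexive (cong (L ℕ.+_) (sym (ℕₚ.+-identityʳ L)))))
                      (ℕₚ.*-monoʳ-≤ 2 2^L≤n)
  square : ∀ E → E ℕ.* E ≡ E ℕ.^ 2
  square E = cong (E ℕ.*_) (sym (ℕₚ.*-identityʳ E))
  regroup : ∀ n L → n ℕ.* ((2 ℕ.* L) ℕ.* (2 ℕ.* n) ℕ.* ((2 ℕ.* L) ℕ.* (2 ℕ.* n))) ≡ 16 ℕ.* n ℕ.^ 3 ℕ.* L ℕ.^ 2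
  regroup = unfolded
    where
    unfolded : ∀ n L → n ℕ.* ((2 ℕ.* L) ℕ.* (2 ℕ.* n) ℕ.* ((2 ℕ.* L) ℕ.* (2 ℕ.* n))) ≡
                       16 ℕ.* (n ℕ.* (n ℕ.* (n ℕ.* 1))) ℕ.* (L ℕ.* (L ℕ.* 1))
    unfolded = NatSolver.solve-∀

corollary4p5 : ∃₂ λ (K N₀ : ℕ) → ∀ (n : ℕ) → N₀ ℕ.≤ n →
    (T : Tournament n) → DoublyRegular T → (c : ℕ) → IsC T c →
    (2 ℕ.* c ℕ.∸ n C 2) ℕ.^ 2 ℕ.≤ K ℕ.* n ℕ.^ 3 ℕ.* ⌊log₂ n ⌋ ℕ.^ 2
-- The bound holds for every ordering, so only the existence half of IsC is used.
corollary4p5 = 16 , 2 , λ where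
  n 2≤n T dr c ((σ , refl) , _) →
    dyadic-≤-log n ⌊log₂ n ⌋ (2 ℕ.* c ℕ.∸ n C 2) (1≤⌊log₂n⌋ 2≤n) (2^⌊log₂n⌋≤n n (ℕₚ.≤-trans (s≤s z≤n) 2≤n))
      (doublyRegular⇒deviation-≤ T dr σ (suc ⌊log₂ n ⌋) (n≤2^[1+⌊log₂n⌋] n))
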